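{- Let $k\ge 2$ be an integer and let $H_0$ be a finite $k$-uniform hypergraph. For the ILTH hypergraphs $H_t=\mathrm{ILTH}_t(H_0)$, let $n(t)=|V(H_t)|$ and $e(t)=|E(H_t)|$. Then for every nonnegative integer $t$: (1) $n(t)=2^t n(0)$; (2) $e(t)=(k+1)^t e(0)$. In particular, if $H_0$ has at least one hyperedge, then $e(t)=\Theta\left(n(t)^{\log_2(k+1)}\right)$ as $t\to\infty$.
   Context: The ILTH (Iterated Local Transitivity Hypergraph) model: fix $k\ge 2$ and a finite $k$-uniform hypergraph $H_0$ (every hyperedge is a $k$-element set of vertices). Given $H_t$, form $H_{t+1}$ as follows: for each vertex $x\in V(H_t)$ add a new vertex $x'$ (the clone of $x$), so $V(H_{t+1})=V(H_t)\cup\{x':x\in V(H_t)\}$; the hyperedge set of $H_{t+1}$ consists of all hyperedges of $H_t$ together with, for every hyperedge $e$ of $H_t$ and every $x\in e$, the hyperedge $e-x+x':=(e\setminus\{x\})\cup\{x'\}$. -}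

module Defs where

open import Data.Nat using (ℕ; zero; suc; _+_)
open import Data.Bool using (Bool; false; true)
open import Data.Bool.Properties using () renaming (_≟_ to _≟ᵇ_)
open import Data.Fin using (Fin)
open import Data.Fin.Subset using (Subset; _∈_; ⊥; ∣_∣; inside; outside)
open import Data.Fin.Subset.Properties using (_∈?_)
open import Data.List using (List; map; concatMap; filter; length; deduplicate; _++_; allFin)
open import Data.List.Relation.Unary.All using (All)
open import Data.Vec using (_[_]≔_) renaming (_++_ to _++ᵥ_)
open import Data.Vec.Properties using (≡-dec)
open import Relation.Binary.PropositionalEquality using (_≡_)

-- The hyperedge SET is the set of elements of the list
-- (multiplicities / order are irrelevant, see edgeCount).
record Hypergraph : Set where
  constructor hypergraph
  field
    nV    : ℕ
    edges : List (Subset nV)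
open Hypergraph public

Uniform : ℕ → Hypergraph → Set
Uniform k H = All (λ e → ∣ e ∣ ≡ k) (edges H)

vertexCount : Hypergraph → ℕ
vertexCount H = nV H

edgeCount : Hypergraph → ℕ
edgeCount H = length (deduplicate (≡-dec _≟ᵇ_) (edges H))

-- New vertex set Fin (n + n): old vertex x is  inject+ n x
-- (the first n positions), its clone x' is  raise n x  (the last n positions).
embed : ∀ {n} → Subset n → Subset (n + n)
embed e = e ++ᵥ ⊥

swapClone : ∀ {n} → Subset n → Fin n → Subset (n + n)
swapClone e x = (e [ x ]≔ outside) ++ᵥ (⊥ [ x ]≔ inside)

members : ∀ {n} → Subset n → List (Fin n)
members e = filter (_∈? e) (allFin _)

iltStep : Hypergraph → Hypergraph
iltStep (hypergraph n E) =
  hypergraph (n + n)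
    (map embed E ++ concatMap (λ e → map (swapClone e) (members e)) E)

ILTH : ℕ → Hypergraph → Hypergraph
ILTH zero    H = H
ILTH (suc t) H = iltStep (ILTH t H)

-- Each vertex receives exactly one clone, so the vertex count doubles at every step.
-- Each hyperedge e of a k-uniform hypergraph survives and spawns the k hyperedges
-- e - x + x' (x ∈ e), and all these hyperedges are pairwise distinct: e - x + x'
-- contains exactly one clone, namely x', and e is recovered from it by putting x back.
-- Hence k-uniformity is preserved and the number of distinct hyperedges is
-- multiplied by k + 1 at every step.
module Submission where

open import Defs
open import Data.Nat using (ℕ; _≤_; _*_; _^_; _+_)
open import Data.Product using (_×_)
open import Relation.Binary.PropositionalEquality using (_≡_)

open import Data.Nat using (zero; suc)
open import Data.Nat.Properties using (+-comm; +-identityʳ; *-assoc; *-suc; *-distribʳ-+; *-zeroʳ)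
open import Data.Bool using (Bool; true; false)
open import Data.Bool.Properties using () renaming (_≟_ to _≟ᵇ_)
open import Data.Product using (_,_; ∃; proj₂)
open import Data.Fin using (Fin) renaming (zero to fzero; suc to fsuc)
open import Data.Fin.Subset using (Subset; inside; outside; ∣_∣; ⁅_⁆)
  renaming (_∈_ to _∈ₛ_; ⊥ to ∅)
open import Data.Fin.Subset.Properties using (_∈?_; ∣⊥∣≡0; ∣⁅x⁆∣≡1; x∈⁅x⁆; x∈⁅y⁆⇒x≡y; ∉⊥)
open import Data.Vec using ([]; _∷_; here; there; lookup; _[_]≔_) renaming (_++_ to _++ᵥ_)
open import Data.Vec.Properties using (≡-dec; []≔-idempotent; []≔-lookup; []=⇒lookup;
  ++-injectiveˡ; ++-injectiveʳ)
open import Data.List using (List; []; _∷_; map; concatMap; filter; length; deduplicate; _++_;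
  allFin; tabulate)
open import Data.List.Properties using (length-++; length-map)
open import Data.List.Relation.Unary.All as All using (All; []; _∷_)
import Data.List.Relation.Unary.All.Properties as All
import Data.List.Relation.Unary.AllPairs as AllPairs
import Data.List.Relation.Unary.AllPairs.Properties as AllPairs
open import Data.List.Relation.Unary.Unique.Propositional using (Unique)
import Data.List.Relation.Unary.Unique.Propositional.Properties as Unique
open import Data.List.Relation.Unary.Unique.DecPropositional.Properties using (deduplicate-!)
open import Data.List.Membership.Propositional using (_∈_)
open import Data.List.Membership.Propositional.Properties
  using (∈-map⁻; ∈-filter⁻; ∈-concat⁻′; ∈-deduplicate⁺; ∈-deduplicate⁻)
open import Data.List.Membership.Propositional.Properties.WithK using (unique∧set⇒bag)
open import Data.List.Relation.Binary.BagAndSetEquality using (∼bag⇒↭)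
open import Data.List.Relation.Binary.Permutation.Propositional.Properties using (↭-length)
open import Data.List.Relation.Binary.Subset.Propositional using (_⊆_)
import Data.List.Relation.Binary.Subset.Propositional.Properties as ⊆
open import Data.List.Relation.Binary.Disjoint.Propositional using (Disjoint)
open import Function.Bundles using (mk⇔)
open import Relation.Binary.PropositionalEquality using (refl; sym; trans; subst; cong; cong₂; module ≡-Reasoning)
open import Relation.Nullary using (Dec; yes; no; ¬_)

open ≡-Reasoning

∣p++q∣ : ∀ {m n} (p : Subset m) (q : Subset n) → ∣ p ++ᵥ q ∣ ≡ ∣ p ∣ + ∣ q ∣
∣p++q∣ []          q = refl
∣p++q∣ (true ∷ p)  q = cong suc (∣p++q∣ p q)
∣p++q∣ (false ∷ p) q = ∣p++q∣ p q

∣p[x]≔outside∣ : ∀ {n} {x : Fin n} {p : Subset n} → x ∈ₛ p → suc ∣ p [ x ]≔ outside ∣ ≡ ∣ p ∣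
∣p[x]≔outside∣                   here       = refl
∣p[x]≔outside∣ {p = true ∷ p}  (there x∈p) = cong suc (∣p[x]≔outside∣ x∈p)
∣p[x]≔outside∣ {p = false ∷ p} (there x∈p) = ∣p[x]≔outside∣ x∈p

∅[x]≔inside≡⁅x⁆ : ∀ {n} (x : Fin n) → ∅ [ x ]≔ inside ≡ ⁅ x ⁆
∅[x]≔inside≡⁅x⁆ fzero    = refl
∅[x]≔inside≡⁅x⁆ (fsuc x) = cong (outside ∷_) (∅[x]≔inside≡⁅x⁆ x)

⁅⁆-injective : ∀ {n} {x y : Fin n} → ⁅ x ⁆ ≡ ⁅ y ⁆ → x ≡ y
⁅⁆-injective {x = x} {y} eq = x∈⁅y⁆⇒x≡y y (subst (x ∈ₛ_) eq (x∈⁅x⁆ x))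

-- Removing a common element x is injective: put x back with _[ x ]≔ inside.
[x]≔outside-injective : ∀ {n} {x : Fin n} {p q : Subset n} → x ∈ₛ p → x ∈ₛ q →
  p [ x ]≔ outside ≡ q [ x ]≔ outside → p ≡ q
[x]≔outside-injective {x = x} {p} {q} x∈p x∈q eq = begin
  p                                ≡⟨ restore p x∈p ⟨
  (p [ x ]≔ outside) [ x ]≔ inside ≡⟨ cong (_[ x ]≔ inside) eq ⟩
  (q [ x ]≔ outside) [ x ]≔ inside ≡⟨ restore q x∈q ⟩
  q                                ∎
  where
  restore : ∀ r → x ∈ₛ r → (r [ x ]≔ outside) [ x ]≔ inside ≡ r
  restore r x∈r = begin
    (r [ x ]≔ outside) [ x ]≔ inside ≡⟨ []≔-idempotent r x ⟩
    r [ x ]≔ inside                  ≡⟨ cong (r [ x ]≔_) ([]=⇒lookup x∈r) ⟨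
    r [ x ]≔ lookup r x              ≡⟨ []≔-lookup r x ⟩
    r                                ∎

filter-∈∷-tabulate : ∀ {j n} (b : Bool) (p : Subset n) (f : Fin j → Fin n) →
  filter (_∈? (b ∷ p)) (tabulate (λ i → fsuc (f i))) ≡ map fsuc (filter (_∈? p) (tabulate f))
filter-∈∷-tabulate {zero}  b p f = refl
filter-∈∷-tabulate {suc j} b p f with f fzero ∈? p
... | yes _ = cong (fsuc (f fzero) ∷_) (filter-∈∷-tabulate b p (λ i → f (fsuc i)))
... | no  _ = filter-∈∷-tabulate b p (λ i → f (fsuc i))

length-members-tail : ∀ {n} (b : Bool) (p : Subset n) →
  length (filter (_∈? (b ∷ p)) (tabulate fsuc)) ≡ length (members p)
length-members-tail b p = begin
  length (filter (_∈? (b ∷ p)) (tabulate fsuc)) ≡⟨ cong length (filter-∈∷-tabulate b p (λ i → i)) ⟩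
  length (map fsuc (members p))                ≡⟨ length-map fsuc (members p) ⟩
  length (members p)                           ∎

length-members : ∀ {n} (p : Subset n) → length (members p) ≡ ∣ p ∣
length-members []          = refl
length-members (true ∷ p)  = cong suc (trans (length-members-tail true p) (length-members p))
length-members (false ∷ p) = trans (length-members-tail false p) (length-members p)

members-unique : ∀ {n} (p : Subset n) → Unique (members p)
members-unique {n} p = Unique.filter⁺ (_∈? p) (Unique.allFin⁺ n)

∈-members⁻ : ∀ {n} {x : Fin n} (p : Subset n) → x ∈ members p → x ∈ₛ p
∈-members⁻ {n} p x∈ = ∈-filter⁻ (_∈? p) {xs = allFin n} x∈ .proj₂

∣embed∣ : ∀ {n} (e : Subset n) → ∣ embed e ∣ ≡ ∣ e ∣
∣embed∣ {n} e = begin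
  ∣ e ++ᵥ ∅ {n} ∣   ≡⟨ ∣p++q∣ e ∅ ⟩
  ∣ e ∣ + ∣ ∅ {n} ∣ ≡⟨ cong (∣ e ∣ +_) (∣⊥∣≡0 n) ⟩
  ∣ e ∣ + 0         ≡⟨ +-identityʳ ∣ e ∣ ⟩
  ∣ e ∣             ∎

∣swapClone∣ : ∀ {n} {x : Fin n} {e : Subset n} → x ∈ₛ e → ∣ swapClone e x ∣ ≡ ∣ e ∣
∣swapClone∣ {x = x} {e} x∈e = begin
  ∣ e-x ++ᵥ (∅ [ x ]≔ inside) ∣      ≡⟨ ∣p++q∣ e-x (∅ [ x ]≔ inside) ⟩
  ∣ e-x ∣ + ∣ ∅ [ x ]≔ inside ∣      ≡⟨ cong (λ s → ∣ e-x ∣ + ∣ s ∣) (∅[x]≔inside≡⁅x⁆ x) ⟩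
  ∣ e-x ∣ + ∣ ⁅ x ⁆ ∣                ≡⟨ cong (∣ e-x ∣ +_) (∣⁅x⁆∣≡1 x) ⟩
  ∣ e-x ∣ + 1                        ≡⟨ +-comm ∣ e-x ∣ 1 ⟩
  suc ∣ e-x ∣                        ≡⟨ ∣p[x]≔outside∣ x∈e ⟩
  ∣ e ∣                              ∎
  where e-x = e [ x ]≔ outside

embed-injective : ∀ {n} {e f : Subset n} → embed e ≡ embed f → e ≡ f
embed-injective {e = e} {f} = ++-injectiveˡ e f

embed≢swapClone : ∀ {n} (e f : Subset n) (x : Fin n) → ¬ (embed e ≡ swapClone f x)
embed≢swapClone e f x eq = ∉⊥ (subst (x ∈ₛ_) (sym ∅≡⁅x⁆) (x∈⁅x⁆ x))
  where
  ∅≡⁅x⁆ : ∅ ≡ ⁅ x ⁆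
  ∅≡⁅x⁆ = trans (++-injectiveʳ e (f [ x ]≔ outside) eq) (∅[x]≔inside≡⁅x⁆ x)

swapClone-injectiveʳ : ∀ {n} {e f : Subset n} {x y : Fin n} → swapClone e x ≡ swapClone f y → x ≡ y
swapClone-injectiveʳ {e = e} {f} {x} {y} eq = ⁅⁆-injective (begin
  ⁅ x ⁆           ≡⟨ ∅[x]≔inside≡⁅x⁆ x ⟨
  ∅ [ x ]≔ inside ≡⟨ ++-injectiveʳ (e [ x ]≔ outside) (f [ y ]≔ outside) eq ⟩
  ∅ [ y ]≔ inside ≡⟨ ∅[x]≔inside≡⁅x⁆ y ⟩
  ⁅ y ⁆           ∎)

swapClone-injectiveˡ : ∀ {n} {e f : Subset n} {x y : Fin n} → x ∈ₛ e → y ∈ₛ f →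
  swapClone e x ≡ swapClone f y → e ≡ f
swapClone-injectiveˡ {e = e} {f} {x} {y} x∈e y∈f eq with swapClone-injectiveʳ {e = e} {f} {x} {y} eq
... | refl = [x]≔outside-injective x∈e y∈f (++-injectiveˡ (e [ x ]≔ outside) (f [ x ]≔ outside) eq)

clones : ∀ {n} → Subset n → List (Subset (n + n))
clones e = map (swapClone e) (members e)

iltEdges : ∀ {n} → List (Subset n) → List (Subset (n + n))
iltEdges E = map embed E ++ concatMap clones E

∈-clones⁻ : ∀ {n} {v : Subset (n + n)} (e : Subset n) → v ∈ clones e →
  ∃ λ x → x ∈ₛ e × v ≡ swapClone e x
∈-clones⁻ e v∈ with ∈-map⁻ (swapClone e) v∈
... | x , x∈ , refl = x , ∈-members⁻ e x∈ , refl

∈-concatMap-clones⁻ : ∀ {n} {v : Subset (n + n)} (E : List (Subset n)) → v ∈ concatMap clones E →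
  ∃ λ e → e ∈ E × v ∈ clones e
∈-concatMap-clones⁻ E v∈ with ∈-concat⁻′ (map clones E) v∈
... | vs , v∈vs , vs∈ with ∈-map⁻ clones vs∈
... | e , e∈E , refl = e , e∈E , v∈vs

iltEdges-uniform : ∀ k {n} (E : List (Subset n)) →
  All (λ e → ∣ e ∣ ≡ k) E → All (λ e → ∣ e ∣ ≡ k) (iltEdges E)
iltEdges-uniform k E uni = All.++⁺ (All.map⁺ (All.map (λ {e} ∣e∣≡k → trans (∣embed∣ e) ∣e∣≡k) uni))
  (All.tabulate λ v∈ → clone-size v∈)
  where
  clone-size : ∀ {v} → v ∈ concatMap clones E → ∣ v ∣ ≡ k
  clone-size v∈ with ∈-concatMap-clones⁻ E v∈
  ... | e , e∈E , v∈clones with ∈-clones⁻ e v∈clones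
  ... | x , x∈e , refl = trans (∣swapClone∣ x∈e) (All.lookup uni e∈E)

length-concatMap-clones : ∀ k {n} (E : List (Subset n)) →
  All (λ e → ∣ e ∣ ≡ k) E → length (concatMap clones E) ≡ k * length E
length-concatMap-clones k []      []            = sym (*-zeroʳ k)
length-concatMap-clones k (e ∷ E) (∣e∣≡k ∷ uni) = begin
  length (clones e ++ concatMap clones E)          ≡⟨ length-++ (clones e) ⟩
  length (clones e) + length (concatMap clones E)  ≡⟨ cong₂ _+_ length-clones (length-concatMap-clones k E uni) ⟩
  k + k * length E                                 ≡⟨ *-suc k (length E) ⟨
  k * suc (length E)                               ∎
  where
  length-clones : length (clones e) ≡ k
  length-clones = begin
    length (map (swapClone e) (members e)) ≡⟨ length-map (swapClone e) (members e) ⟩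
    length (members e)                     ≡⟨ length-members e ⟩
    ∣ e ∣                                  ≡⟨ ∣e∣≡k ⟩
    k                                      ∎

length-iltEdges : ∀ k {n} (E : List (Subset n)) →
  All (λ e → ∣ e ∣ ≡ k) E → length (iltEdges E) ≡ (k + 1) * length E
length-iltEdges k E uni = begin
  length (map embed E ++ concatMap clones E)         ≡⟨ length-++ (map embed E) ⟩
  length (map embed E) + length (concatMap clones E) ≡⟨ cong₂ _+_ (length-map embed E) (length-concatMap-clones k E uni) ⟩
  length E + k * length E                            ≡⟨ +-comm (length E) (k * length E) ⟩
  k * length E + length E                            ≡⟨ cong (k * length E +_) (+-identityʳ (length E)) ⟨
  k * length E + 1 * length E                        ≡⟨ *-distribʳ-+ (length E) k 1 ⟨
  (k + 1) * length E                                 ∎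

iltEdges-unique : ∀ {n} {E : List (Subset n)} → Unique E → Unique (iltEdges E)
iltEdges-unique {E = E} uniq = Unique.++⁺ (Unique.map⁺ embed-injective uniq)
  (Unique.concat⁺ (All.map⁺ (All.tabulate (λ {e} _ → clones-unique e)))
    (AllPairs.map⁺ (AllPairs.map clones-disjoint uniq)))
  embeds-clones-disjoint
  where
  clones-unique : ∀ e → Unique (clones e)
  clones-unique e = Unique.map⁺ swapClone-injectiveʳ (members-unique e)

  clones-disjoint : ∀ {e f} → ¬ e ≡ f → Disjoint (clones e) (clones f)
  clones-disjoint {e} {f} e≢f (v∈e , v∈f) with ∈-clones⁻ e v∈e | ∈-clones⁻ f v∈f
  ... | x , x∈e , refl | y , y∈f , eq = e≢f (swapClone-injectiveˡ x∈e y∈f eq)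

  embeds-clones-disjoint : Disjoint (map embed E) (concatMap clones E)
  embeds-clones-disjoint (v∈embeds , v∈clones) with ∈-map⁻ embed v∈embeds | ∈-concatMap-clones⁻ E v∈clones
  ... | e , _ , refl | f , _ , v∈ with ∈-clones⁻ f v∈
  ... | x , _ , eq = embed≢swapClone e f x eq

iltEdges-mono : ∀ {n} {E F : List (Subset n)} → E ⊆ F → iltEdges E ⊆ iltEdges F
iltEdges-mono E⊆F = ⊆.++⁺ (⊆.map⁺ embed E⊆F) (⊆.concatMap⁺ clones E⊆F)

unique-⊆⊇⇒length≡ : ∀ {a} {A : Set a} {xs ys : List A} → Unique xs → Unique ys →
  xs ⊆ ys → ys ⊆ xs → length xs ≡ length ys
unique-⊆⊇⇒length≡ xs! ys! xs⊆ys ys⊆xs =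
  ↭-length (∼bag⇒↭ (unique∧set⇒bag xs! ys! (mk⇔ xs⊆ys ys⊆xs)))

iltStep-uniform : ∀ k (H : Hypergraph) → Uniform k H → Uniform k (iltStep H)
iltStep-uniform k H = iltEdges-uniform k (edges H)

-- iltEdges commutes with deduplication up to set equality, and both sides are
-- duplicate-free, hence permutations of each other.
edgeCount-iltStep : ∀ k (H : Hypergraph) → Uniform k H →
  edgeCount (iltStep H) ≡ (k + 1) * edgeCount H
edgeCount-iltStep k (hypergraph n E) uni = begin
  length (dedup (iltEdges E))  ≡⟨ unique-⊆⊇⇒length≡ (deduplicate-! _≟_ (iltEdges E))
                                    (iltEdges-unique (deduplicate-! _≟_ E))
                                    dedup-iltEdges⊆iltEdges-dedup iltEdges-dedup⊆dedup-iltEdges ⟩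
  length (iltEdges (dedup E))  ≡⟨ length-iltEdges k (dedup E) (All.deduplicate⁺ _≟_ uni) ⟩
  (k + 1) * length (dedup E)   ∎
  where
  _≟_ : ∀ {m} (p q : Subset m) → Dec (p ≡ q)
  _≟_ = ≡-dec _≟ᵇ_

  dedup : ∀ {m} → List (Subset m) → List (Subset m)
  dedup = deduplicate _≟_

  dedup-iltEdges⊆iltEdges-dedup : dedup (iltEdges E) ⊆ iltEdges (dedup E)
  dedup-iltEdges⊆iltEdges-dedup v∈ =
    iltEdges-mono {E = E} (∈-deduplicate⁺ _≟_) (∈-deduplicate⁻ _≟_ (iltEdges E) v∈)

  iltEdges-dedup⊆dedup-iltEdges : iltEdges (dedup E) ⊆ dedup (iltEdges E)
  iltEdges-dedup⊆dedup-iltEdges v∈ =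
    ∈-deduplicate⁺ _≟_ (iltEdges-mono {E = dedup E} (∈-deduplicate⁻ _≟_ E) v∈)

ILTH-uniform : ∀ k (H : Hypergraph) (t : ℕ) → Uniform k H → Uniform k (ILTH t H)
ILTH-uniform k H zero    uni = uni
ILTH-uniform k H (suc t) uni = iltStep-uniform k (ILTH t H) (ILTH-uniform k H t uni)

vertexCount-ILTH : ∀ (H : Hypergraph) (t : ℕ) → vertexCount (ILTH t H) ≡ 2 ^ t * vertexCount H
vertexCount-ILTH H zero    = sym (+-identityʳ (vertexCount H))
vertexCount-ILTH H (suc t) = begin
  vertexCount (ILTH t H) + vertexCount (ILTH t H) ≡⟨ cong₂ _+_ (vertexCount-ILTH H t) (vertexCount-ILTH H t) ⟩
  2 ^ t * v + 2 ^ t * v                           ≡⟨ cong (2 ^ t * v +_) (+-identityʳ (2 ^ t * v)) ⟨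
  2 * (2 ^ t * v)                                 ≡⟨ *-assoc 2 (2 ^ t) v ⟨
  2 ^ suc t * v                                   ∎
  where v = vertexCount H

edgeCount-ILTH : ∀ k (H : Hypergraph) (t : ℕ) → Uniform k H →
  edgeCount (ILTH t H) ≡ (k + 1) ^ t * edgeCount H
edgeCount-ILTH k H zero    uni = sym (+-identityʳ (edgeCount H))
edgeCount-ILTH k H (suc t) uni = begin
  edgeCount (iltStep (ILTH t H))        ≡⟨ edgeCount-iltStep k (ILTH t H) (ILTH-uniform k H t uni) ⟩
  (k + 1) * edgeCount (ILTH t H)        ≡⟨ cong ((k + 1) *_) (edgeCount-ILTH k H t uni) ⟩
  (k + 1) * ((k + 1) ^ t * edgeCount H) ≡⟨ *-assoc (k + 1) ((k + 1) ^ t) (edgeCount H) ⟨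
  (k + 1) ^ suc t * edgeCount H         ∎

-- The counts hold for every k.
theorem1 : (k : ℕ) → 2 ≤ k → (H₀ : Hypergraph) → Uniform k H₀ → (t : ℕ) →
    (vertexCount (ILTH t H₀) ≡ 2 ^ t * vertexCount H₀)
    × (edgeCount (ILTH t H₀) ≡ (k + 1) ^ t * edgeCount H₀)
theorem1 k _ H₀ uni t = vertexCount-ILTH H₀ t , edgeCount-ILTH k H₀ t uni
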